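{- Let $n\ge 6$. The graph $G(3,n)$ is bipartite with partite sets $X=\{v: v\equiv 0 \pmod 4\}$ and $Y=\{v : v\equiv 2\pmod 4\}$, and its vertex set can be partitioned into an independent set $I$ and a set inducing a path $P$ such that every vertex of $P$ is adjacent to all vertices of $I$ lying in the partite set opposite to it (so consecutive vertices of $P$ are alternately adjacent to all of $I\cap Y$ and all of $I\cap X$), and these together with the edges of $P$ are all the edges of $G(3,n)$. Moreover, $G(3,1)\cong K_1$, $G(3,2)\cong K_2$, $G(3,3)\cong P_3$, $G(3,4)\cong C_4$, and $G(3,5)$ consists of a $4$-cycle together with a pendant vertex attached to one vertex of the cycle.
   Context: For a prime $p$ and $n\in\mathbb{N}$, $G(p,n)$ is the simple graph with vertex set $\{2,4,\ldots,2n\}$ in which two distinct vertices $a,b$ are adjacent if and only if both $\frac{a+b}{2}$ and $\frac{|a-b|}{2}$ are odd positive integers neither of which equals $pk$ for an integer $k\ge 2$. $P_k$ denotes the path on $k$ vertices and $C_k$ the cycle on $k$ vertices. -}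

module Defs where

open import Data.Nat using (ℕ; zero; suc; _+_; _*_; _≤_; _<_; ∣_-_∣)
open import Data.Nat.DivMod using (_/_; _%_)
open import Data.Fin using (Fin; toℕ)
open import Data.List using (List; _∷_; _++_)
open import Data.List.Membership.Propositional using (_∈_)
open import Data.List.Relation.Unary.Unique.Propositional using (Unique)
open import Data.Product using (Σ; ∃; _×_; _,_; proj₁)
open import Data.Sum using (_⊎_)
open import Relation.Nullary using (¬_)
open import Relation.Binary.PropositionalEquality using (_≡_; _≢_)
open import Function.Bundles using (_⇔_; _↔_; Inverse)

Odd : ℕ → Set
Odd m = m % 2 ≡ 1

IsBigMultiple : ℕ → ℕ → Set
IsBigMultiple p m = ∃ λ k → 2 ≤ k × m ≡ p * k

AdjNat : ℕ → ℕ → ℕ → Set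
AdjNat p a b =
  a ≢ b
  × (0 < (a + b) / 2 × Odd ((a + b) / 2) × ¬ IsBigMultiple p ((a + b) / 2))
  × (0 < ∣ a - b ∣ / 2 × Odd (∣ a - b ∣ / 2) × ¬ IsBigMultiple p (∣ a - b ∣ / 2))

Graph : ℕ → Set₁
Graph n = Fin n → Fin n → Set

-- The vertex i : Fin n of G(p,n) is the even number 2 (i + 1) ∈ {2, 4, …, 2n}.
val : ∀ {n} → Fin n → ℕ
val i = 2 * suc (toℕ i)

G : ℕ → (n : ℕ) → Graph n
G p n u v = AdjNat p (val u) (val v)

_≅_ : ∀ {n m} → Graph n → Graph m → Set
_≅_ {n} {m} H K =
  Σ (Fin n ↔ Fin m) λ f → ∀ u v → H u v ⇔ K (Inverse.to f u) (Inverse.to f v)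

K₁ : Graph 1
K₁ u v = Data.Empty.⊥
  where import Data.Empty

PathG : (k : ℕ) → Graph k
PathG k u v = toℕ v ≡ suc (toℕ u) ⊎ toℕ u ≡ suc (toℕ v)

K₂ : Graph 2
K₂ u v = u ≢ v

CycleG : (k : ℕ) → Graph k
CycleG k u v = PathG k u v ⊎ (toℕ u ≡ 0 × suc (toℕ v) ≡ k) ⊎ (toℕ v ≡ 0 × suc (toℕ u) ≡ k)

C4Pendant : Graph 5
C4Pendant u v =
  (toℕ u < 4 × toℕ v < 4 × (toℕ v ≡ suc (toℕ u) ⊎ toℕ u ≡ suc (toℕ v)
     ⊎ (toℕ u ≡ 0 × toℕ v ≡ 3) ⊎ (toℕ v ≡ 0 × toℕ u ≡ 3)))
  ⊎ (toℕ u ≡ 4 × toℕ v ≡ 0) ⊎ (toℕ u ≡ 0 × toℕ v ≡ 4)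

Consec : ∀ {A : Set} → List A → A → A → Set
Consec P u v = ∃ λ xs → ∃ λ ys → P ≡ xs ++ (u ∷ v ∷ ys)

InX InY : ∀ {n} → Fin n → Set
InX v = val v % 4 ≡ 0
InY v = val v % 4 ≡ 2

Opposite : ∀ {n} → Fin n → Fin n → Set
Opposite u v = (InX u × InY v) ⊎ (InY u × InX v)

BipartiteXY : ∀ {n} → Graph n → Set
BipartiteXY {n} H =
  (∀ (v : Fin n) → (InX v × ¬ InY v) ⊎ (InY v × ¬ InX v))
  × (∀ u v → H u v → Opposite u v)

-- Vertex set partitioned into I (a predicate) and the vertices of a path P
-- (a duplicate-free nonempty list, in path order), such that the edges of H
-- are exactly: consecutive pairs of P, and pairs (u ∈ P, w ∈ I) in opposite
-- partite sets. (In particular I is independent and P induces a path.)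
PathIndepStructure : ∀ {n} → Graph n → Set₁
PathIndepStructure {n} H =
  Σ (Fin n → Set) λ I → Σ (List (Fin n)) λ P →
    (∃ λ x → ∃ λ xs → P ≡ x ∷ xs)
    × Unique P
    × (∀ v → I v ⊎ v ∈ P)
    × (∀ v → ¬ (I v × v ∈ P))
    × (∀ u v → H u v ⇔
         (Consec P u v ⊎ Consec P v u
          ⊎ (u ∈ P × I v × Opposite u v)
          ⊎ (I u × v ∈ P × Opposite u v)))

{-# OPTIONS --safe #-}
-- Write the vertices as 2(k+1) with k = toℕ v.  Two vertices are adjacent iff k + l + 2 and |k − l|
-- are both odd and each is either 3 or prime to 3.  Oddness says that k and l have opposite parity,
-- i.e. the vertices lie in opposite partite sets.  Both numbers are prime to 3 exactly when one of
-- the vertices is a multiple of 6 and the other is not; the multiples of 6 form the independent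
-- set I.  The value 3 yields the extra edges 2–4 and a–(a+6) for 3 ∤ a, which string the remaining
-- vertices into the path …, 14, 8, 2, 4, 10, 16, …  Mechanically, adjacency and this description are
-- both Boolean functions of k and the gap d = l − k that are 6-periodic in k (for k ≥ 1) and in d
-- (for d ≥ 4), so their agreement is a finite check; the small graphs are checked by evaluation.
module Submission where

open import Algebra.Properties.CommutativeSemigroup using (x∙yz≈y∙xz)
open import Data.Bool using (Bool; true; false; T; not; _∧_; _∨_; _xor_; if_then_else_)
import Data.Bool.Properties as Bool
open import Data.Bool.Properties using (T-∧; T-∨; xor-comm; xor-inverseˡ; xor-inverseʳ)
open import Data.Empty using (⊥-elim)
open import Data.Fin as Fin using (Fin; toℕ; #_; zero; suc)
open import Data.Fin.Properties using (all?; toℕ-fromℕ<; toℕ<n; toℕ-injective)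
open import Data.Integer as ℤ using (ℤ; -[1+_]; -<-; -<+; +<+)
open import Data.Integer.Properties using () renaming (<-trans to ℤ<-trans; <-irrefl to ℤ<-irrefl)
open import Data.List using (List; []; _∷_; _++_; applyUpTo; applyDownFrom; last; head)
open import Data.List.Membership.Propositional using (_∈_)
open import Data.List.Membership.Propositional.Properties
  using (∈-++⁺ˡ; ∈-++⁺ʳ; ∈-++⁻; ∈-applyUpTo⁺; ∈-applyUpTo⁻; ∈-applyDownFrom⁺; ∈-applyDownFrom⁻)
import Data.List.Relation.Unary.All as All
open import Data.List.Relation.Unary.AllPairs as AllPairs using (_∷_)
open import Data.List.Relation.Unary.Any using (here; there)
open import Data.List.Relation.Unary.Linked as Linked using (Linked; _∷_)
open import Data.List.Relation.Unary.Linked.Properties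
  using (Linked⇒AllPairs; ++⁺; applyUpTo⁺₁; applyDownFrom⁺₁)
open import Data.List.Relation.Unary.Unique.Propositional using (Unique)
open import Data.Maybe using (just; nothing)
open import Data.Maybe.Relation.Binary.Connected as Connected using (Connected)
open import Data.Nat
  using (ℕ; zero; suc; _+_; _*_; _≤_; _<_; _≡ᵇ_; ∣_-_∣; z≤n; s≤s; _≟_; _<?_; NonZero; >-nonZero⁻¹)
open import Data.Nat.Divisibility using (_∣_; divides; _∣?_; ∣m∣n⇒∣m+n; ∣m+n∣m⇒∣n)
open import Data.Nat.DivMod
  using ( _/_; _%_; _mod_; m*n/n≡m; m/n*n≤m; /-monoˡ-≤; m<n⇒m%n≡m; m≡m%n+[m/n]*n
        ; [m+kn]%n≡m%n; m*n%n≡0)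
open import Data.Nat.Properties
  using ( +-commutativeSemigroup; +-comm; +-suc; +-cancelˡ-≡; +-cancelˡ-≤; +-monoʳ-≤
        ; *-comm; *-distribˡ-+; *-distribˡ-∣-∣; *-cancelˡ-≡; *-monoˡ-≤; *-monoʳ-≤
        ; ≤-refl; ≤-trans; ≤-pred; ≤-total; <-trans; <⇒≢; <⇒≱; n<1+n; m≤m+n; m≤n+m; m<n+m
        ; suc-injective; ∣n-n∣≡0; ∣m-m+n∣≡n; ∣-∣-comm; m≤n⇒∃[o]m+o≡n)
open import Data.Product using (_×_; _,_; proj₁; proj₂; ∃)
open import Data.Product.Function.NonDependent.Propositional using (_×-⇔_)
open import Data.Sum using (_⊎_; inj₁; inj₂; assocʳ; assocˡ)
open import Data.Sum.Function.Propositional using (_⊎-⇔_)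
open import Function.Base using (_∘_; id)
open import Function.Bundles using (_⇔_; mk⇔; Equivalence; mk↔ₛ′)
open import Function.Properties.Equivalence
  using () renaming (refl to ⇔-refl; sym to ⇔-sym; trans to ⇔-trans)
open import Relation.Binary.Core using (_⇒_)
open import Relation.Binary.Definitions using (Transitive; Irreflexive)
open import Relation.Binary.PropositionalEquality
open import Relation.Nullary using (¬_; contradiction)
open import Relation.Nullary.Decidable
  using (Dec; no; isYes; True; from-no; toWitness; fromWitness; ¬?; _⊎-dec_; _×-dec_)

open import Defs

+-left-comm : ∀ k c x → k + (c + x) ≡ c + (k + x)
+-left-comm = x∙yz≈y∙xz +-commutativeSemigroup

Good : ℕ → Set
Good m = 0 < m × Odd m × ¬ IsBigMultiple 3 m

coprime6 : ℕ → Bool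
coprime6 m = (m % 6 ≡ᵇ 1) ∨ (m % 6 ≡ᵇ 5)

good : ℕ → Bool
good m = (m ≡ᵇ 3) ∨ coprime6 m

3∣6+m⇔3∣m : ∀ m → 3 ∣ 6 + m ⇔ 3 ∣ m
3∣6+m⇔3∣m m = mk⇔ (λ h → ∣m+n∣m⇒∣n h (divides 2 refl)) (∣m∣n⇒∣m+n (divides 2 refl))

IsBigMultiple3[6+m]⇔3∣m : ∀ m → IsBigMultiple 3 (6 + m) ⇔ 3 ∣ m
IsBigMultiple3[6+m]⇔3∣m m = mk⇔ to from
  where
  to : IsBigMultiple 3 (6 + m) → 3 ∣ m
  to (suc (suc q) , _ , eq) =
    divides q (trans (+-cancelˡ-≡ 6 m (3 * q) (trans eq (*-distribˡ-+ 3 2 q))) (*-comm 3 q))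
  from : 3 ∣ m → IsBigMultiple 3 (6 + m)
  from (divides q eq) =
    2 + q , s≤s (s≤s z≤n) , trans (cong (6 +_) (trans eq (*-comm q 3))) (sym (*-distribˡ-+ 3 2 q))

<6⇒¬IsBigMultiple3 : ∀ {m} → m < 6 → ¬ IsBigMultiple 3 m
<6⇒¬IsBigMultiple3 m<6 (q , 2≤q , refl) = <⇒≱ m<6 (*-monoʳ-≤ 3 2≤q)

coprime6⇔ : ∀ m → T (coprime6 m) ⇔ (Odd m × ¬ 3 ∣ m)
coprime6⇔ 0 = mk⇔ (λ ()) (λ ())
coprime6⇔ 1 = mk⇔ (λ _ → refl , from-no (3 ∣? 1)) (λ _ → _)
coprime6⇔ 2 = mk⇔ (λ ()) (λ ())
coprime6⇔ 3 = mk⇔ (λ ()) (λ (_ , 3∤3) → 3∤3 (divides 1 refl))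
coprime6⇔ 4 = mk⇔ (λ ()) (λ ())
coprime6⇔ 5 = mk⇔ (λ _ → refl , from-no (3 ∣? 5)) (λ _ → _)
coprime6⇔ (suc (suc (suc (suc (suc (suc m)))))) = mk⇔
  (λ t → let (odd-m , 3∤m) = Equivalence.to (coprime6⇔ m) t
         in odd-m , 3∤m ∘ Equivalence.to (3∣6+m⇔3∣m m))
  (λ (odd-m , 3∤6+m) → Equivalence.from (coprime6⇔ m)
                          (odd-m , 3∤6+m ∘ Equivalence.from (3∣6+m⇔3∣m m)))

good⇔Good : ∀ m → T (good m) ⇔ Good m
good⇔Good 0 = mk⇔ (λ ()) (λ ())
good⇔Good 1 = mk⇔ (λ _ → s≤s z≤n , refl , <6⇒¬IsBigMultiple3 (s≤s (s≤s z≤n))) (λ _ → _)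
good⇔Good 2 = mk⇔ (λ ()) (λ { (_ , () , _) })
good⇔Good 3 = mk⇔ (λ _ → s≤s z≤n , refl , <6⇒¬IsBigMultiple3 (s≤s (s≤s (s≤s (s≤s z≤n))))) (λ _ → _)
good⇔Good 4 = mk⇔ (λ ()) (λ { (_ , () , _) })
good⇔Good 5 = mk⇔ (λ _ → s≤s z≤n , refl , <6⇒¬IsBigMultiple3 ≤-refl) (λ _ → _)
good⇔Good (suc (suc (suc (suc (suc (suc m)))))) = mk⇔
  (λ t → let (odd-m , 3∤m) = Equivalence.to (coprime6⇔ m) t
         in s≤s z≤n , odd-m , 3∤m ∘ Equivalence.to (IsBigMultiple3[6+m]⇔3∣m m))
  (λ (_ , odd-m , ¬big) → Equivalence.from (coprime6⇔ m)
                            (odd-m , ¬big ∘ Equivalence.from (IsBigMultiple3[6+m]⇔3∣m m)))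

adj : ℕ → ℕ → Bool
adj k l = good (2 + k + l) ∧ good ∣ k - l ∣

[2*m]/2≡m : ∀ m → (2 * m) / 2 ≡ m
[2*m]/2≡m m = trans (cong (_/ 2) (*-comm 2 m)) (m*n/n≡m m 2)

half-sum : ∀ k l → (2 * suc k + 2 * suc l) / 2 ≡ 2 + k + l
half-sum k l = begin
  (2 * suc k + 2 * suc l) / 2  ≡⟨ cong (_/ 2) (*-distribˡ-+ 2 (suc k) (suc l)) ⟨
  (2 * (suc k + suc l)) / 2    ≡⟨ [2*m]/2≡m (suc k + suc l) ⟩
  suc k + suc l                ≡⟨ cong suc (+-suc k l) ⟩
  2 + k + l                    ∎
  where open ≡-Reasoning

half-diff : ∀ k l → ∣ 2 * suc k - 2 * suc l ∣ / 2 ≡ ∣ k - l ∣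
half-diff k l = trans (cong (_/ 2) (sym (*-distribˡ-∣-∣ 2 (suc k) (suc l)))) ([2*m]/2≡m ∣ k - l ∣)

G⇔adj : ∀ {n} (u v : Fin n) → G 3 n u v ⇔ T (adj (toℕ u) (toℕ v))
G⇔adj u v = mk⇔ to from
  where
  k = toℕ u
  l = toℕ v
  to : G 3 _ u v → T (adj k l)
  to (_ , good-sum , good-diff) = Equivalence.from T-∧
    ( Equivalence.from (good⇔Good _) (subst Good (half-sum k l) good-sum)
    , Equivalence.from (good⇔Good _) (subst Good (half-diff k l) good-diff))
  from : T (adj k l) → G 3 _ u v
  from t = distinct , subst Good (sym (half-sum k l)) (Equivalence.to (good⇔Good _) t-sum)
                    , subst Good (sym (half-diff k l)) (Equivalence.to (good⇔Good _) t-diff)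
    where
    t-sum = proj₁ (Equivalence.to T-∧ t)
    t-diff = proj₂ (Equivalence.to T-∧ t)
    distinct : 2 * suc k ≢ 2 * suc l
    distinct eq = subst (T ∘ good) (trans (cong (∣ k -_∣) (sym k≡l)) (∣n-n∣≡0 k)) t-diff
      where k≡l = suc-injective (*-cancelˡ-≡ (suc k) (suc l) 2 eq)

adj-sym : ∀ k l → adj k l ≡ adj l k
adj-sym k l = cong₂ (λ s m → good (2 + s) ∧ good m) (+-comm k l) (∣-∣-comm k l)

inI : ℕ → Bool
inI k = k % 3 ≡ᵇ 2

odd : ℕ → Bool
odd k = k % 2 ≡ᵇ 1

cross : ℕ → ℕ → Bool
cross k l = (odd k xor odd l) ∧ (inI k xor inI l)

-- Every test is _≡ᵇ_
-- against a constant or a residue modulo a divisor of 6, ordered so that it reduces, hence shifting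
-- k ≥ 1 or d ≥ 4 by 6 leaves them unchanged definitionally, up to reassociating sums.
pathᵈ : ℕ → ℕ → Bool
pathᵈ k d = ((d ≡ᵇ 1) ∧ (k ≡ᵇ 0)) ∨ ((d ≡ᵇ 3) ∧ not (inI k))

structᵈ : ℕ → ℕ → Bool
structᵈ k d = pathᵈ k d ∨ cross k (k + d)

adjᵈ : ℕ → ℕ → Bool
adjᵈ k d = good (2 + k + (k + d)) ∧ good d

adjᵈ-periodicᵏ : ∀ k d → adjᵈ (7 + k) d ≡ adjᵈ (1 + k) d
adjᵈ-periodicᵏ k d = trans (cong (λ m → good (9 + m) ∧ good d) (+-left-comm k 7 (k + d)))
                           (sym (cong (λ m → good (3 + m) ∧ good d) (+-suc k (k + d))))

adjᵈ-periodicᵈ : ∀ k d → adjᵈ k (10 + d) ≡ adjᵈ k (4 + d)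
adjᵈ-periodicᵈ k d = trans (cong (λ m → good (2 + m) ∧ good (4 + d)) (shift 10))
                           (sym (cong (λ m → good (2 + m) ∧ good (4 + d)) (shift 4)))
  where
  shift : ∀ c → k + (k + (c + d)) ≡ c + (k + (k + d))
  shift c = trans (cong (k +_) (+-left-comm k c d)) (+-left-comm k c (k + d))

structᵈ-periodicᵈ : ∀ k d → structᵈ k (10 + d) ≡ structᵈ k (4 + d)
structᵈ-periodicᵈ k d = cong (λ l → pathᵈ k (4 + d) ∨ cross k l) (+-left-comm k 6 (4 + d))

adjᵈ≡structᵈ-table : ∀ (i : Fin 7) (j : Fin 10) → adjᵈ (toℕ i) (toℕ j) ≡ structᵈ (toℕ i) (toℕ j)
adjᵈ≡structᵈ-table =
  toWitness {a? = all? λ i → all? λ j → adjᵈ (toℕ i) (toℕ j) Bool.≟ structᵈ (toℕ i) (toℕ j)} _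

adjᵈ≡structᵈ-row : ∀ (i : Fin 7) d → adjᵈ (toℕ i) d ≡ structᵈ (toℕ i) d
adjᵈ≡structᵈ-row i (suc (suc (suc (suc (suc (suc (suc (suc (suc (suc d)))))))))) =
  trans (adjᵈ-periodicᵈ (toℕ i) d)
        (trans (adjᵈ≡structᵈ-row i (suc (suc (suc (suc d))))) (sym (structᵈ-periodicᵈ (toℕ i) d)))
adjᵈ≡structᵈ-row i 0 = adjᵈ≡structᵈ-table i (# 0)
adjᵈ≡structᵈ-row i 1 = adjᵈ≡structᵈ-table i (# 1)
adjᵈ≡structᵈ-row i 2 = adjᵈ≡structᵈ-table i (# 2)
adjᵈ≡structᵈ-row i 3 = adjᵈ≡structᵈ-table i (# 3)
adjᵈ≡structᵈ-row i 4 = adjᵈ≡structᵈ-table i (# 4)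
adjᵈ≡structᵈ-row i 5 = adjᵈ≡structᵈ-table i (# 5)
adjᵈ≡structᵈ-row i 6 = adjᵈ≡structᵈ-table i (# 6)
adjᵈ≡structᵈ-row i 7 = adjᵈ≡structᵈ-table i (# 7)
adjᵈ≡structᵈ-row i 8 = adjᵈ≡structᵈ-table i (# 8)
adjᵈ≡structᵈ-row i 9 = adjᵈ≡structᵈ-table i (# 9)

adjᵈ≡structᵈ : ∀ k d → adjᵈ k d ≡ structᵈ k d
adjᵈ≡structᵈ (suc (suc (suc (suc (suc (suc (suc k))))))) d =
  trans (adjᵈ-periodicᵏ k d) (adjᵈ≡structᵈ (suc k) d)
adjᵈ≡structᵈ 0 = adjᵈ≡structᵈ-row (# 0)
adjᵈ≡structᵈ 1 = adjᵈ≡structᵈ-row (# 1)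
adjᵈ≡structᵈ 2 = adjᵈ≡structᵈ-row (# 2)
adjᵈ≡structᵈ 3 = adjᵈ≡structᵈ-row (# 3)
adjᵈ≡structᵈ 4 = adjᵈ≡structᵈ-row (# 4)
adjᵈ≡structᵈ 5 = adjᵈ≡structᵈ-row (# 5)
adjᵈ≡structᵈ 6 = adjᵈ≡structᵈ-row (# 6)

-- Next k l: the index l follows k on the path …, 7, 4, 1, 0, 3, 6, … through the indices ≢ 2 (mod 3).
data Next : ℕ → ℕ → Set where
  turn    : Next 1 0
  descend : ∀ {k} → k % 3 ≡ 1 → Next (3 + k) k
  ascend  : ∀ {k} → k % 3 ≡ 0 → Next k (3 + k)

Edge : ℕ → ℕ → Set
Edge k l = Next k l ⊎ Next l k ⊎ T (cross k l)

residue3 : ∀ k → k % 3 ≡ 0 ⊎ k % 3 ≡ 1 ⊎ k % 3 ≡ 2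
residue3 0 = inj₁ refl
residue3 1 = inj₂ (inj₁ refl)
residue3 2 = inj₂ (inj₂ refl)
residue3 (suc (suc (suc k))) = residue3 k

notInI⇔ : ∀ k → T (not (inI k)) ⇔ (k % 3 ≡ 0 ⊎ k % 3 ≡ 1)
notInI⇔ k = mk⇔ to from
  where
  to : T (not (inI k)) → k % 3 ≡ 0 ⊎ k % 3 ≡ 1
  to t with residue3 k
  ... | inj₁ r = inj₁ r
  ... | inj₂ (inj₁ r) = inj₂ r
  ... | inj₂ (inj₂ r) = ⊥-elim (subst (λ m → T (not (m ≡ᵇ 2))) r t)
  from : k % 3 ≡ 0 ⊎ k % 3 ≡ 1 → T (not (inI k))
  from (inj₁ r) = subst (λ m → T (not (m ≡ᵇ 2))) (sym r) _
  from (inj₂ r) = subst (λ m → T (not (m ≡ᵇ 2))) (sym r) _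

m<3+m+n : ∀ m n → m < 3 + m + n
m<3+m+n m n = s≤s (≤-trans (m≤m+n m n) (m≤n+m (m + n) 2))

pathᵈ-sound : ∀ k d → T (pathᵈ k d) → Next k (k + d) ⊎ Next (k + d) k
pathᵈ-sound 0 1 _ = inj₂ turn
pathᵈ-sound (suc k) 1 ()
pathᵈ-sound k 3 t with Equivalence.to (notInI⇔ k) t
... | inj₁ r = inj₁ (subst (Next k) (+-comm 3 k) (ascend r))
... | inj₂ r = inj₂ (subst (λ m → Next m k) (+-comm 3 k) (descend r))
pathᵈ-sound k 0 ()
pathᵈ-sound k 2 ()
pathᵈ-sound k (suc (suc (suc (suc d)))) ()

pathᵈ-complete : ∀ k d → Next k (k + d) ⊎ Next (k + d) k → T (pathᵈ k d)
pathᵈ-complete k d = λ { (inj₁ next) → forward next refl ; (inj₂ next) → backward next refl }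
  where
  gap3 : ∀ {j} → 3 + j ≡ j + d → j % 3 ≡ 0 ⊎ j % 3 ≡ 1 → T (pathᵈ j d)
  gap3 {j} eq r = subst (T ∘ pathᵈ j) (+-cancelˡ-≡ j 3 d (trans (+-comm j 3) eq))
                        (Equivalence.from (notInI⇔ j) r)
  forward : ∀ {a l} → Next a l → l ≡ a + d → T (pathᵈ a d)
  forward turn ()
  forward (descend _) eq = ⊥-elim (<⇒≢ (m<3+m+n _ d) eq)
  forward (ascend r) eq = gap3 eq (inj₁ r)
  backward : ∀ {a l} → Next l a → l ≡ a + d → T (pathᵈ a d)
  backward turn eq = subst (T ∘ pathᵈ 0) eq _
  backward (descend r) eq = gap3 eq (inj₂ r)
  backward (ascend _) eq = ⊥-elim (<⇒≢ (m<3+m+n _ d) eq)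

structᵈ⇔Edge : ∀ k d → T (structᵈ k d) ⇔ Edge k (k + d)
structᵈ⇔Edge k d =
  ⇔-trans T-∨ (⇔-trans (mk⇔ (pathᵈ-sound k d) (pathᵈ-complete k d) ⊎-⇔ ⇔-refl) (mk⇔ assocʳ assocˡ))

Edge-sym : ∀ k l → Edge k l → Edge l k
Edge-sym k l (inj₁ next) = inj₂ (inj₁ next)
Edge-sym k l (inj₂ (inj₁ next)) = inj₁ next
Edge-sym k l (inj₂ (inj₂ c)) =
  inj₂ (inj₂ (subst T (cong₂ _∧_ (xor-comm (odd k) (odd l)) (xor-comm (inI k) (inI l))) c))

adj⇔Edge-≤ : ∀ k d → T (adj k (k + d)) ⇔ Edge k (k + d)
adj⇔Edge-≤ k d = subst (λ b → T b ⇔ Edge k (k + d)) (sym adj≡structᵈ) (structᵈ⇔Edge k d)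
  where
  adj≡structᵈ : adj k (k + d) ≡ structᵈ k d
  adj≡structᵈ = trans (cong (λ m → good (2 + k + (k + d)) ∧ good m) (∣m-m+n∣≡n k d)) (adjᵈ≡structᵈ k d)

adj⇔Edge : ∀ k l → T (adj k l) ⇔ Edge k l
adj⇔Edge k l with ≤-total k l
... | inj₁ k≤l with d , refl ← m≤n⇒∃[o]m+o≡n k≤l = adj⇔Edge-≤ k d
... | inj₂ l≤k with d , refl ← m≤n⇒∃[o]m+o≡n l≤k =
  mk⇔ (λ t → Edge-sym l k (Equivalence.to (adj⇔Edge-≤ l d) (subst T (adj-sym k l) t)))
      (λ e → subst T (adj-sym l k) (Equivalence.from (adj⇔Edge-≤ l d) (Edge-sym k l e)))

odd-suc : ∀ k → odd (suc k) ≡ not (odd k)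
odd-suc 0 = refl
odd-suc 1 = refl
odd-suc (suc (suc k)) = odd-suc k

Next-flips-parity : ∀ {k l} → Next k l → T (odd k xor odd l)
Next-flips-parity turn = _
Next-flips-parity (descend {k} _) =
  subst T (sym (trans (cong (_xor odd k) (odd-suc k)) (xor-inverseˡ (odd k)))) _
Next-flips-parity (ascend {k} _) =
  subst T (sym (trans (cong (odd k xor_) (odd-suc k)) (xor-inverseʳ (odd k)))) _

Edge-flips-parity : ∀ {k l} → Edge k l → T (odd k xor odd l)
Edge-flips-parity (inj₁ next) = Next-flips-parity next
Edge-flips-parity {k} {l} (inj₂ (inj₁ next)) = subst T (xor-comm (odd l) (odd k)) (Next-flips-parity next)
Edge-flips-parity (inj₂ (inj₂ c)) = proj₁ (Equivalence.to T-∧ c)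

[2*suc[k]]%4 : ∀ k → (2 * suc k) % 4 ≡ (if odd k then 0 else 2)
[2*suc[k]]%4 0 = refl
[2*suc[k]]%4 1 = refl
[2*suc[k]]%4 (suc (suc k)) = trans (cong (_% 4) (*-distribˡ-+ 2 2 (suc k))) ([2*suc[k]]%4 k)

InX⊎InY : ∀ {n} (v : Fin n) → (InX v × ¬ InY v) ⊎ (InY v × ¬ InX v)
InX⊎InY v with odd (toℕ v) | [2*suc[k]]%4 (toℕ v)
... | true | eq = inj₁ (eq , λ y → contradiction (trans (sym eq) y) λ ())
... | false | eq = inj₂ (eq , λ x → contradiction (trans (sym eq) x) λ ())

InX⇔odd : ∀ {n} (v : Fin n) → InX v ⇔ T (odd (toℕ v))
InX⇔odd v with odd (toℕ v) | [2*suc[k]]%4 (toℕ v)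
... | true | eq = mk⇔ (λ _ → _) (λ _ → eq)
... | false | eq = mk⇔ (λ x → contradiction (trans (sym eq) x) λ ()) (λ ())

InY⇔even : ∀ {n} (v : Fin n) → InY v ⇔ T (not (odd (toℕ v)))
InY⇔even v with odd (toℕ v) | [2*suc[k]]%4 (toℕ v)
... | true | eq = mk⇔ (λ y → contradiction (trans (sym eq) y) λ ()) (λ ())
... | false | eq = mk⇔ (λ _ → _) (λ _ → eq)

T-xor : ∀ a b → T (a xor b) ⇔ ((T a × T (not b)) ⊎ (T (not a) × T b))
T-xor false false = mk⇔ (λ ()) λ { (inj₁ (() , _)) ; (inj₂ (_ , ())) }
T-xor false true = mk⇔ (λ _ → inj₂ _) (λ _ → _)
T-xor true false = mk⇔ (λ _ → inj₁ _) (λ _ → _)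
T-xor true true = mk⇔ (λ ()) λ { (inj₁ (_ , ())) ; (inj₂ (() , _)) }

Opposite⇔ : ∀ {n} (u v : Fin n) → Opposite u v ⇔ T (odd (toℕ u) xor odd (toℕ v))
Opposite⇔ u v =
  ⇔-trans ((InX⇔odd u ×-⇔ InY⇔even v) ⊎-⇔ (InY⇔even u ×-⇔ InX⇔odd v)) (⇔-sym (T-xor _ _))

T-∧-xor : ∀ o a b → T (o ∧ (a xor b)) ⇔ ((T (not a) × T b × T o) ⊎ (T a × T (not b) × T o))
T-∧-xor false a b = mk⇔ (λ ()) λ { (inj₁ (_ , _ , ())) ; (inj₂ (_ , _ , ())) }
T-∧-xor true false false = mk⇔ (λ ()) λ { (inj₁ (_ , () , _)) ; (inj₂ (() , _ , _)) }
T-∧-xor true false true = mk⇔ (λ _ → inj₁ _) (λ _ → _)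
T-∧-xor true true false = mk⇔ (λ _ → inj₂ _) (λ _ → _)
T-∧-xor true true true = mk⇔ (λ ()) λ { (inj₁ (() , _ , _)) ; (inj₂ (_ , () , _)) }

Consec-∷ : ∀ {A : Set} {x : A} {xs u v} → Consec xs u v → Consec (x ∷ xs) u v
Consec-∷ {x = x} (as , bs , eq) = x ∷ as , bs , cong (x ∷_) eq

∈⇒nonempty : ∀ {A : Set} {x : A} {xs} → x ∈ xs → ∃ λ y → ∃ λ ys → xs ≡ y ∷ ys
∈⇒nonempty (here _) = _ , _ , refl
∈⇒nonempty (there _) = _ , _ , refl

module _ {A : Set} {R : A → A → Set} where

  Linked-Consec : ∀ {xs u v} → Linked R xs → Consec xs u v → R u v
  Linked-Consec lk ([] , _ , refl) = Linked.head lk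
  Linked-Consec lk (_ ∷ as , bs , refl) = Linked-Consec (Linked.tail lk) (as , bs , refl)

  Linked-applyDownFrom++applyUpTo :
    ∀ f g a b → (∀ {i} → suc i < a → R (f (suc i)) (f i)) →
    (∀ {i} → suc i < b → R (g i) (g (suc i))) → (0 < a → 0 < b → R (f 0) (g 0)) →
    Linked R (applyDownFrom f a ++ applyUpTo g b)
  Linked-applyDownFrom++applyUpTo f g a b down up join =
    ++⁺ (applyDownFrom⁺₁ f a down) (connect a b join) (applyUpTo⁺₁ g b up)
    where
    last-applyDownFrom : ∀ a → last (applyDownFrom f (suc a)) ≡ just (f 0)
    last-applyDownFrom 0 = refl
    last-applyDownFrom (suc a) = last-applyDownFrom a
    connect : ∀ a b → (0 < a → 0 < b → R (f 0) (g 0)) →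
              Connected R (last (applyDownFrom f a)) (head (applyUpTo g b))
    connect 0 0 _ = Connected.nothing
    connect 0 (suc b) _ = Connected.nothing-just
    connect (suc a) 0 _ =
      subst (λ m → Connected R m nothing) (sym (last-applyDownFrom a)) Connected.just-nothing
    connect (suc a) (suc b) join = subst (λ m → Connected R m (just (g 0))) (sym (last-applyDownFrom a))
                                         (Connected.just (join (s≤s z≤n) (s≤s z≤n)))

  module _ (R-injectiveˡ : ∀ {a b c} → R a c → R b c → a ≡ b) where

    Linked-tail⇒Consec : ∀ {x xs u v} → Linked R (x ∷ xs) → v ∈ xs → R u v → Consec (x ∷ xs) u v
    Linked-tail⇒Consec {xs = _ ∷ ys} (rxy ∷ _) (here refl) ruv with refl ← R-injectiveˡ ruv rxy =
      [] , ys , refl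
    Linked-tail⇒Consec (_ ∷ lk) (there v∈) ruv = Consec-∷ (Linked-tail⇒Consec lk v∈ ruv)

  module _ {_<_ : A → A → Set} (R⇒< : R ⇒ _<_) (<-trans : Transitive _<_) (<-irrefl : Irreflexive _≡_ _<_)
           where

    Linked⇒Unique : ∀ {xs} → Linked R xs → Unique xs
    Linked⇒Unique lk =
      AllPairs.map (λ x<y x≡y → <-irrefl x≡y x<y) (Linked⇒AllPairs <-trans (Linked.map R⇒< lk))

    Linked-head-no-pred : ∀ {x xs u} → Linked R (x ∷ xs) → u ∈ x ∷ xs → ¬ R u x
    Linked-head-no-pred _ (here refl) rxx = <-irrefl refl (R⇒< rxx)
    Linked-head-no-pred lk (there u∈) rux with x<xs ∷ _ ← Linked⇒AllPairs <-trans (Linked.map R⇒< lk) =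
      <-irrefl refl (<-trans (R⇒< rux) (All.lookup x<xs u∈))

    Linked⇒Consec : (∀ {a b c} → R a c → R b c → a ≡ b) →
                    ∀ {xs u v} → Linked R xs → u ∈ xs → v ∈ xs → R u v → Consec xs u v
    Linked⇒Consec _ lk u∈ (here refl) ruv = ⊥-elim (Linked-head-no-pred lk u∈ ruv)
    Linked⇒Consec R-injectiveˡ lk _ (there v∈) ruv = Linked-tail⇒Consec R-injectiveˡ lk v∈ ruv

Next-injectiveˡ : ∀ {a b c} → Next a c → Next b c → a ≡ b
Next-injectiveˡ turn turn = refl
Next-injectiveˡ turn (descend ())
Next-injectiveˡ (descend ()) turn
Next-injectiveˡ (descend _) (descend _) = refl
Next-injectiveˡ (descend r) (ascend r′) with () ← trans (sym r) r′
Next-injectiveˡ (ascend r′) (descend r) with () ← trans (sym r) r′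
Next-injectiveˡ (ascend _) (ascend _) = refl

-- Indices ≡ 1 (mod 3) precede 0 on the path, hence the negative ranks.
rank : ℕ → ℤ
rank k = if k % 3 ≡ᵇ 1 then -[1+ k ] else ℤ.+ k

Next⇒rank< : ∀ {k l} → Next k l → rank k ℤ.< rank l
Next⇒rank< turn = -<+
Next⇒rank< (descend {k} r) rewrite r = -<- (m<n+m k (s≤s z≤n))
Next⇒rank< (ascend {k} r) rewrite r = +<+ (m<n+m k (s≤s z≤n))

Next-source : ∀ {k l} → Next k l → k % 3 ≡ 0 ⊎ k % 3 ≡ 1
Next-source turn = inj₂ refl
Next-source (descend r) = inj₂ r
Next-source (ascend r) = inj₁ r

Next-target : ∀ {k l} → Next k l → l % 3 ≡ 0 ⊎ l % 3 ≡ 1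
Next-target turn = inj₁ refl
Next-target (descend r) = inj₂ r
Next-target (ascend r) = inj₁ r

≤/⇔*≤ : ∀ k x m .{{_ : NonZero m}} → k ≤ x / m ⇔ k * m ≤ x
≤/⇔*≤ k x m = mk⇔ (λ h → ≤-trans (*-monoˡ-≤ m h) (m/n*n≤m x m))
                  (λ h → subst (_≤ x / m) (m*n/n≡m k m) (/-monoˡ-≤ m h))

<⇔<count : ∀ {c x n} i → c + x ≡ 2 + n → c + i * 3 < n ⇔ i < x / 3
<⇔<count {c} {x} {n} i eq = mk⇔ to from
  where
  shift : c + (3 + i * 3) ≡ 3 + (c + i * 3)
  shift = +-left-comm c 3 (i * 3)
  to : c + i * 3 < n → i < x / 3
  to h = Equivalence.from (≤/⇔*≤ (suc i) x 3)
           (+-cancelˡ-≤ c _ _ (subst₂ _≤_ (sym shift) (sym eq) (s≤s (s≤s h))))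
  from : i < x / 3 → c + i * 3 < n
  from h = ≤-pred (≤-pred (subst₂ _≤_ shift eq (+-monoʳ-≤ c (Equivalence.to (≤/⇔*≤ (suc i) x 3) h))))

module Path (n : ℕ) .{{_ : NonZero n}} where

  -- A total stand-in for the vertex with index k, correct when k < n.
  vertex : ℕ → Fin n
  vertex k = k mod n

  toℕ-vertex : ∀ {k} → k < n → toℕ (vertex k) ≡ k
  toℕ-vertex k<n = trans (toℕ-fromℕ< _) (m<n⇒m%n≡m k<n)

  NextF : Fin n → Fin n → Set
  NextF u v = Next (toℕ u) (toℕ v)

  chain : ℕ → ℕ → Fin n
  chain c i = vertex (c + i * 3)

  -- (1 + n) / 3 and (2 + n) / 3 are the numbers of indices below n that are ≡ 1 and ≡ 0 (mod 3).
  descending ascending path : List (Fin n)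
  descending = applyDownFrom (chain 1) ((1 + n) / 3)
  ascending = applyUpTo (chain 0) ((2 + n) / 3)
  path = descending ++ ascending

  toℕ-chain : ∀ c {x} i → c + x ≡ 2 + n → i < x / 3 → toℕ (chain c i) ≡ c + i * 3
  toℕ-chain c i eq i<count = toℕ-vertex (Equivalence.from (<⇔<count i eq) i<count)

  chain-residue : ∀ c {x} i → c + x ≡ 2 + n → i < x / 3 → toℕ (chain c i) % 3 ≡ c % 3
  chain-residue c i eq i<count = trans (cong (_% 3) (toℕ-chain c i eq i<count)) ([m+kn]%n≡m%n c i 3)

  chain-complete : ∀ c {x} (v : Fin n) → c + x ≡ 2 + n → toℕ v % 3 ≡ c →
                   ∃ λ i → i < x / 3 × v ≡ chain c i
  chain-complete c v eq r =
    toℕ v / 3 , i<count , toℕ-injective (trans decomposition (sym (toℕ-vertex bound)))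
    where
    decomposition : toℕ v ≡ c + toℕ v / 3 * 3
    decomposition = trans (m≡m%n+[m/n]*n (toℕ v) 3) (cong (_+ toℕ v / 3 * 3) r)
    bound : c + toℕ v / 3 * 3 < n
    bound = subst (_< n) decomposition (toℕ<n v)
    i<count = Equivalence.to (<⇔<count (toℕ v / 3) eq) bound

  path-linked : Linked NextF path
  path-linked = Linked-applyDownFrom++applyUpTo (chain 1) (chain 0) _ _ down up join
    where
    down : ∀ {i} → suc i < (1 + n) / 3 → NextF (chain 1 (suc i)) (chain 1 i)
    down {i} si< = subst₂ Next (sym (toℕ-chain 1 (suc i) refl si<))
                               (sym (toℕ-chain 1 i refl (<-trans (n<1+n i) si<)))
                               (descend ([m+kn]%n≡m%n 1 i 3))
    up : ∀ {i} → suc i < (2 + n) / 3 → NextF (chain 0 i) (chain 0 (suc i))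
    up {i} si< = subst₂ Next (sym (toℕ-chain 0 i refl (<-trans (n<1+n i) si<)))
                             (sym (toℕ-chain 0 (suc i) refl si<))
                             (ascend (m*n%n≡0 i 3))
    join : 0 < (1 + n) / 3 → 0 < (2 + n) / 3 → NextF (chain 1 0) (chain 0 0)
    join 0<a 0<b = subst₂ Next (sym (toℕ-chain 1 0 refl 0<a)) (sym (toℕ-chain 0 0 refl 0<b)) turn

  ∈path⇔ : ∀ v → v ∈ path ⇔ (toℕ v % 3 ≡ 0 ⊎ toℕ v % 3 ≡ 1)
  ∈path⇔ v = mk⇔ to from
    where
    to : v ∈ path → toℕ v % 3 ≡ 0 ⊎ toℕ v % 3 ≡ 1
    to v∈ with ∈-++⁻ descending v∈
    ... | inj₁ v∈d with i , i< , refl ← ∈-applyDownFrom⁻ (chain 1) v∈d = inj₂ (chain-residue 1 i refl i<)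
    ... | inj₂ v∈a with i , i< , refl ← ∈-applyUpTo⁻ (chain 0) v∈a = inj₁ (chain-residue 0 i refl i<)
    from : toℕ v % 3 ≡ 0 ⊎ toℕ v % 3 ≡ 1 → v ∈ path
    from (inj₁ r) with i , i< , refl ← chain-complete 0 v refl r =
      ∈-++⁺ʳ descending (∈-applyUpTo⁺ (chain 0) i<)
    from (inj₂ r) with i , i< , refl ← chain-complete 1 v refl r =
      ∈-++⁺ˡ (∈-applyDownFrom⁺ (chain 1) i<)

  _≺_ : Fin n → Fin n → Set
  u ≺ v = rank (toℕ u) ℤ.< rank (toℕ v)

  ≺-irrefl : Irreflexive _≡_ _≺_
  ≺-irrefl refl = ℤ<-irrefl refl

  path-unique : Unique path
  path-unique = Linked⇒Unique Next⇒rank< ℤ<-trans ≺-irrefl path-linked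

  Consec-path⇔ : ∀ u v → Consec path u v ⇔ NextF u v
  Consec-path⇔ u v = mk⇔ (Linked-Consec path-linked) λ next →
    Linked⇒Consec Next⇒rank< ℤ<-trans ≺-irrefl (λ p q → toℕ-injective (Next-injectiveˡ p q)) path-linked
      (Equivalence.from (∈path⇔ u) (Next-source next))
      (Equivalence.from (∈path⇔ v) (Next-target next))
      next

module _ (n : ℕ) .{{_ : NonZero n}} where
  open Path n

  I : Fin n → Set
  I v = T (inI (toℕ v))

  ∈path⇔¬I : ∀ v → v ∈ path ⇔ T (not (inI (toℕ v)))
  ∈path⇔¬I v = ⇔-trans (∈path⇔ v) (⇔-sym (notInI⇔ (toℕ v)))

  I⊎path : ∀ v → I v ⊎ v ∈ path
  I⊎path v with inI (toℕ v) | ∈path⇔¬I v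
  ... | true | _ = inj₁ _
  ... | false | v∈⇔ = inj₂ (Equivalence.from v∈⇔ _)

  I-path-disjoint : ∀ v → ¬ (T (inI (toℕ v)) × v ∈ path)
  I-path-disjoint v with inI (toℕ v) | ∈path⇔¬I v
  ... | true | v∈⇔ = λ (_ , v∈) → Equivalence.to v∈⇔ v∈
  ... | false | _ = λ (i , _) → i

  path-nonempty : ∃ λ x → ∃ λ xs → path ≡ x ∷ xs
  path-nonempty =
    ∈⇒nonempty (Equivalence.from (∈path⇔ (vertex 0)) (inj₁ (cong (_% 3) (toℕ-vertex (>-nonZero⁻¹ n)))))

  G⇔path-structure : ∀ u v → G 3 n u v ⇔ (Consec path u v ⊎ Consec path v u
                                          ⊎ (u ∈ path × I v × Opposite u v) ⊎ (I u × v ∈ path × Opposite u v))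
  G⇔path-structure u v = ⇔-trans (G⇔adj u v) (⇔-trans (adj⇔Edge k l)
    (⇔-sym (Consec-path⇔ u v ⊎-⇔ Consec-path⇔ v u ⊎-⇔ ⇔-trans
      ((∈path⇔¬I u ×-⇔ ⇔-refl ×-⇔ Opposite⇔ u v) ⊎-⇔ (⇔-refl ×-⇔ ∈path⇔¬I v ×-⇔ Opposite⇔ u v))
      (⇔-sym (T-∧-xor (odd k xor odd l) (inI k) (inI l))))))
    where
    k = toℕ u
    l = toℕ v

  G-bipartite : BipartiteXY (G 3 n)
  G-bipartite = InX⊎InY , λ u v g →
    Equivalence.from (Opposite⇔ u v)
      (Edge-flips-parity (Equivalence.to (adj⇔Edge (toℕ u) (toℕ v)) (Equivalence.to (G⇔adj u v) g)))

  G-path-structure : PathIndepStructure (G 3 n)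
  G-path-structure = I , path , path-nonempty , path-unique , I⊎path , I-path-disjoint , G⇔path-structure

≅-by-decision : ∀ {m} {H K : Graph m} (h : Fin m → Fin m → Bool) (K? : ∀ u v → Dec (K u v))
                (f g : Fin m → Fin m) →
                (∀ u v → H u v ⇔ T (h u v)) →
                {_ : True (all? λ y → f (g y) Fin.≟ y)} {_ : True (all? λ x → g (f x) Fin.≟ x)} →
                {_ : True (all? λ u → all? λ v → h u v Bool.≟ isYes (K? (f u) (f v)))} →
                H ≅ K
≅-by-decision h K? f g H⇔h {fg} {gf} {h≡K} = mk↔ₛ′ f g (toWitness fg) (toWitness gf) , λ u v →
  ⇔-trans (H⇔h u v) (mk⇔ (λ t → toWitness {a? = K? (f u) (f v)} (subst T (toWitness h≡K u v) t))
                         (λ k → subst T (sym (toWitness h≡K u v)) (fromWitness k)))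

adjᶠ : ∀ {m} → Fin m → Fin m → Bool
adjᶠ u v = adj (toℕ u) (toℕ v)

K₁? : ∀ u v → Dec (K₁ u v)
K₁? _ _ = no λ ()

K₂? : ∀ u v → Dec (K₂ u v)
K₂? u v = ¬? (u Fin.≟ v)

PathG? : ∀ k (u v : Fin k) → Dec (PathG k u v)
PathG? k u v = (toℕ v ≟ suc (toℕ u)) ⊎-dec (toℕ u ≟ suc (toℕ v))

CycleG? : ∀ k (u v : Fin k) → Dec (CycleG k u v)
CycleG? k u v =
  PathG? k u v ⊎-dec ((toℕ u ≟ 0) ×-dec (suc (toℕ v) ≟ k)) ⊎-dec ((toℕ v ≟ 0) ×-dec (suc (toℕ u) ≟ k))

C4Pendant? : ∀ u v → Dec (C4Pendant u v)
C4Pendant? u v =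
  ((toℕ u <? 4) ×-dec (toℕ v <? 4) ×-dec
     ((toℕ v ≟ suc (toℕ u)) ⊎-dec (toℕ u ≟ suc (toℕ v))
      ⊎-dec ((toℕ u ≟ 0) ×-dec (toℕ v ≟ 3)) ⊎-dec ((toℕ v ≟ 0) ×-dec (toℕ u ≟ 3))))
  ⊎-dec ((toℕ u ≟ 4) ×-dec (toℕ v ≟ 0)) ⊎-dec ((toℕ u ≟ 0) ×-dec (toℕ v ≟ 4))

-- In G(3,5) the 4-cycle is 2–4–6–8 and the pendant 10 hangs at 4.
G₅-relabel G₅-relabel⁻¹ : Fin 5 → Fin 5
G₅-relabel zero = # 3
G₅-relabel (suc zero) = # 0
G₅-relabel (suc (suc zero)) = # 1
G₅-relabel (suc (suc (suc zero))) = # 2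
G₅-relabel (suc (suc (suc (suc zero)))) = # 4
G₅-relabel⁻¹ zero = # 1
G₅-relabel⁻¹ (suc zero) = # 2
G₅-relabel⁻¹ (suc (suc zero)) = # 3
G₅-relabel⁻¹ (suc (suc (suc zero))) = # 0
G₅-relabel⁻¹ (suc (suc (suc (suc zero)))) = # 4

theorem3p1 :
    ((n : ℕ) → 6 ≤ n → BipartiteXY (G 3 n) × PathIndepStructure (G 3 n))
    × (G 3 1 ≅ K₁)
    × (G 3 2 ≅ K₂)
    × (G 3 3 ≅ PathG 3)
    × (G 3 4 ≅ CycleG 4)
    × (G 3 5 ≅ C4Pendant)
theorem3p1 =
  (λ { (suc n) _ → G-bipartite (suc n) , G-path-structure (suc n) })
  , ≅-by-decision adjᶠ K₁? id id G⇔adj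
  , ≅-by-decision adjᶠ K₂? id id G⇔adj
  , ≅-by-decision adjᶠ (PathG? 3) id id G⇔adj
  , ≅-by-decision adjᶠ (CycleG? 4) id id G⇔adj
  , ≅-by-decision adjᶠ C4Pendant? G₅-relabel G₅-relabel⁻¹ G⇔adj
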